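{- (Degree Domination) Let $\mathsf{APX}$ be a triangle-free 2-matching of an undirected graph $G=(V,E)$, and let $\mathsf{OPT}$ be a maximum-cardinality triangle-free 2-matching of $G$ which, among all maximum-cardinality triangle-free 2-matchings, maximizes $|\mathsf{APX}\cap\mathsf{OPT}|$. Then for every $u\in V$, $|N_{\mathsf{APX}}(u)|\leq|N_{\mathsf{OPT}}(u)|$.
   Context: A 2-matching of $G=(V,E)$ is a set $M\subseteq E$ such that each node is incident to at most two edges of $M$; it is triangle-free if $(V,M)$ contains no triangle. For $S\subseteq E$ and $u\in V$, $N_S(u)$ denotes the set of neighbors of $u$ in the graph $(V,S)$. -}

module Defs where

open import Data.Nat using (ℕ; zero; suc; _+_; _≤_; _<ᵇ_)
open import Data.Bool using (Bool; true; false; _∧_)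
open import Data.Fin using (Fin; toℕ)
open import Data.Empty using (⊥)
open import Data.Product using (_×_)
open import Relation.Binary.PropositionalEquality using (_≡_)

count : ∀ {n} → (Fin n → Bool) → ℕ
count {zero}  p = 0
count {suc n} p with p Fin.zero
... | true  = suc (count (λ i → p (Fin.suc i)))
... | false = count (λ i → p (Fin.suc i))

record Graph (n : ℕ) : Set where
  field
    adj    : Fin n → Fin n → Bool
    sym    : ∀ u v → adj u v ≡ adj v u
    irrefl : ∀ u → adj u u ≡ false
open Graph public

EdgeSet : ℕ → Set
EdgeSet n = Fin n → Fin n → Bool

IsEdgeSubset : ∀ {n} → Graph n → EdgeSet n → Set
IsEdgeSubset {n} G M =
  (∀ u v → M u v ≡ M v u) × (∀ u v → M u v ≡ true → adj G u v ≡ true)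

nbrCount : ∀ {n} → EdgeSet n → Fin n → ℕ
nbrCount M u = count (M u)

-- |M| : number of edges, each unordered pair {u,v} counted once (u < v)
size : ∀ {n} → EdgeSet n → ℕ
size {n} M = go {n} (λ u → count (λ v → M u v ∧ (toℕ u <ᵇ toℕ v)))
  where
  go : ∀ {m} → (Fin m → ℕ) → ℕ
  go {zero}  f = 0
  go {suc m} f = f Fin.zero + go (λ i → f (Fin.suc i))

_∩_ : ∀ {n} → EdgeSet n → EdgeSet n → EdgeSet n
(M ∩ M') u v = M u v ∧ M' u v

Is2Matching : ∀ {n} → Graph n → EdgeSet n → Set
Is2Matching {n} G M = IsEdgeSubset G M × (∀ (u : Fin n) → nbrCount M u ≤ 2)

TriangleFree : ∀ {n} → EdgeSet n → Set
TriangleFree {n} M =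
  ∀ (a b c : Fin n) → M a b ≡ true → M b c ≡ true → M c a ≡ true → ⊥

IsTF2Matching : ∀ {n} → Graph n → EdgeSet n → Set
IsTF2Matching G M = Is2Matching G M × TriangleFree M

IsMaxTF2Matching : ∀ {n} → Graph n → EdgeSet n → Set
IsMaxTF2Matching G OPT =
  IsTF2Matching G OPT × (∀ M → IsTF2Matching G M → size M ≤ size OPT)

-- Suppose |N_A(u)| > |N_O(u)|. Then u has at most one O-neighbour and an A-edge uv ∉ O.
-- Adding uv to O gives a larger triangle-free 2-matching, contradicting maximality, unless v
-- already has two O-neighbours or u and v have a common O-neighbour. In those cases some
-- O-edge vy ∉ A can be dropped from O + uv: the result is again a maximum triangle-free
-- 2-matching, and it shares one more edge with A than O does, contradicting the choice of O.
-- Such a y exists unless the unique O-neighbour x of u has vx ∈ A; then a second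
-- A-neighbour of u takes the place of v.
module Submission where

open import Defs hiding (sym)
open import Data.Nat using (ℕ; _≤_)
open import Data.Fin using (Fin)

open import Data.Bool using (Bool; true; false; _∧_; if_then_else_)
open import Data.Bool.Properties using (∧-zeroʳ; T-≡; ¬-not; not-¬) renaming (_≟_ to _≟ᵇ_)
open import Data.Empty using (⊥; ⊥-elim)
open import Data.Fin using (zero; suc; toℕ; punchIn)
open import Data.Fin.Properties using (punchInᵢ≢i; toℕ-injective; any?) renaming (_≟_ to _≟ᶠ_)
open import Data.Nat using (zero; suc; _+_; _<_; _<ᵇ_; z≤n; s≤s; _≤?_)
open import Data.Nat.Properties
  using (+-0-commutativeMonoid; +-mono-≤; ≤-trans; ≤-reflexive; ≤-pred; ≤⇒≯; <⇒≱; ≰⇒>; ≮⇒≥;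
         suc-injective; <-cmp; <-asym; <ᵇ⇒<; <⇒<ᵇ)
open import Data.Product using (_×_; _,_; proj₁; proj₂; ∃; map)
open import Data.Sum using (_⊎_; inj₁; inj₂)
open import Data.Vec.Functional using (updateAt)
open import Data.Vec.Functional.Properties using (updateAt-updates; updateAt-minimal)
open import Function using (_∘_; const; id; Equivalence)
open import Relation.Binary.Definitions using (tri<; tri≈; tri>)
open import Relation.Binary.PropositionalEquality
open import Relation.Nullary using (Dec; yes; no; ¬_; _×-dec_; _⊎-dec_; contradiction)
open import Algebra.Properties.CommutativeMonoid.Sum +-0-commutativeMonoid using (sum; sum-cong-≗; sum-remove)

sum-mono : ∀ {m} {f g : Fin m → ℕ} → (∀ i → f i ≤ g i) → sum f ≤ sum g
sum-mono {zero}  f≤g = z≤n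
sum-mono {suc m} f≤g = +-mono-≤ (f≤g zero) (sum-mono (f≤g ∘ suc))

sum-suc-at : ∀ {m} {f g : Fin m → ℕ} (k : Fin m) → g k ≡ suc (f k)
           → (∀ i → i ≢ k → f i ≡ g i) → sum g ≡ suc (sum f)
sum-suc-at {suc m} {f} {g} k gk≡ elsewhere = begin
  sum g                            ≡⟨ sum-remove {i = k} g ⟩
  g k + sum (g ∘ punchIn k)        ≡⟨ cong₂ _+_ gk≡ (sum-cong-≗ λ j → sym (elsewhere _ (punchInᵢ≢i k j))) ⟩
  suc (f k + sum (f ∘ punchIn k))  ≡⟨ cong suc (sum-remove {i = k} f) ⟨
  suc (sum f)                      ∎
  where open ≡-Reasoning

indicator : Bool → ℕ
indicator b = if b then 1 else 0

count≡sum : ∀ {n} (p : Fin n → Bool) → count p ≡ sum (indicator ∘ p)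
count≡sum {zero}  p = refl
count≡sum {suc n} p with p zero
... | true  = cong suc (count≡sum (p ∘ suc))
... | false = count≡sum (p ∘ suc)

count-cong : ∀ {n} {p q : Fin n → Bool} → (∀ i → p i ≡ q i) → count p ≡ count q
count-cong {p = p} {q} p≗q = begin
  count p              ≡⟨ count≡sum p ⟩
  sum (indicator ∘ p)  ≡⟨ sum-cong-≗ (cong indicator ∘ p≗q) ⟩
  sum (indicator ∘ q)  ≡⟨ count≡sum q ⟨
  count q              ∎
  where open ≡-Reasoning

count-mono : ∀ {n} {p q : Fin n → Bool} → (∀ i → p i ≡ true → q i ≡ true) → count p ≤ count q
count-mono {p = p} {q} p⊆q =
  subst₂ _≤_ (sym (count≡sum p)) (sym (count≡sum q)) (sum-mono indicator-mono)
  where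
  indicator-mono : ∀ i → indicator (p i) ≤ indicator (q i)
  indicator-mono i with p i in pi
  ... | false = z≤n
  ... | true rewrite p⊆q i pi = s≤s z≤n

count-suc-at : ∀ {n} {p q : Fin n → Bool} (k : Fin n) → p k ≡ false → q k ≡ true
             → (∀ i → i ≢ k → p i ≡ q i) → count q ≡ suc (count p)
count-suc-at {p = p} {q} k pk qk elsewhere = begin
  count q                    ≡⟨ count≡sum q ⟩
  sum (indicator ∘ q)        ≡⟨ sum-suc-at k (trans (cong indicator qk) (cong (suc ∘ indicator) (sym pk)))
                                              (λ i i≢k → cong indicator (elsewhere i i≢k)) ⟩
  suc (sum (indicator ∘ p))  ≡⟨ cong suc (count≡sum p) ⟨
  suc (count p)              ∎
  where open ≡-Reasoning

∃-of-count-pos : ∀ {n} (p : Fin n → Bool) → 0 < count p → ∃ λ i → p i ≡ true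
∃-of-count-pos {suc n} p pos with p zero in p0
... | true  = zero , p0
... | false = map suc id (∃-of-count-pos (p ∘ suc) pos)

∃-of-count< : ∀ {n} (p q : Fin n → Bool) → count q < count p → ∃ λ i → p i ≡ true × q i ≡ false
∃-of-count< p q q<p with any? (λ i → (p i ≟ᵇ true) ×-dec (q i ≟ᵇ false))
... | yes witness = witness
... | no  none    = contradiction (count-mono p⊆q) (<⇒≱ q<p)
  where
  p⊆q : ∀ i → p i ≡ true → q i ≡ true
  p⊆q i pi = ¬-not λ qi → none (i , pi , qi)

_─_ : ∀ {n} → (Fin n → Bool) → Fin n → Fin n → Bool
p ─ i = updateAt p i (const false)

─-elsewhere : ∀ {n} (p : Fin n → Bool) {i j} → j ≢ i → (p ─ i) j ≡ p j
─-elsewhere p {i} {j} = updateAt-minimal j i p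

count-─ : ∀ {n} (p : Fin n → Bool) {i} → p i ≡ true → count p ≡ suc (count (p ─ i))
count-─ p {i} pi = count-suc-at i (updateAt-updates i p) pi (λ j → ─-elsewhere p)

0<count : ∀ {n} (p : Fin n → Bool) {i} → p i ≡ true → 0 < count p
0<count p pi rewrite count-─ p pi = s≤s z≤n

1<count : ∀ {n} (p : Fin n → Bool) {i j} → j ≢ i → p i ≡ true → p j ≡ true → 1 < count p
1<count p j≢i pi pj rewrite count-─ p pi = s≤s (0<count (p ─ _) (trans (─-elsewhere p j≢i) pj))

2<count : ∀ {n} (p : Fin n → Bool) {i j k} → j ≢ i → k ≢ i → k ≢ j
        → p i ≡ true → p j ≡ true → p k ≡ true → 2 < count p
2<count p j≢i k≢i k≢j pi pj pk rewrite count-─ p pi =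
  s≤s (1<count (p ─ _) k≢j (trans (─-elsewhere p j≢i) pj) (trans (─-elsewhere p k≢i) pk))

count≤1⇒unique : ∀ {n} (p : Fin n → Bool) {i j} → count p ≤ 1 → p i ≡ true → p j ≡ true → j ≡ i
count≤1⇒unique p {i} {j} ≤1 pi pj with j ≟ᶠ i
... | yes j≡i = j≡i
... | no  j≢i = contradiction (1<count p j≢i pi pj) (≤⇒≯ ≤1)

∃-other : ∀ {n} (p : Fin n → Bool) {i} → 1 < count p → p i ≡ true → ∃ λ j → p j ≡ true × j ≢ i
∃-other p {i} >1 pi with ∃-of-count-pos (p ─ i) (≤-pred (subst (1 <_) (count-─ p pi) >1))
... | j , pj with j ≟ᶠ i
...   | yes refl = contradiction (trans (sym pj) (updateAt-updates i p)) λ ()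
...   | no  j≢i  = j , trans (sym (─-elsewhere p j≢i)) pj , j≢i

SamePair : ∀ {n} → Fin n → Fin n → Fin n → Fin n → Set
SamePair a b p q = (p ≡ a × q ≡ b) ⊎ (p ≡ b × q ≡ a)

samePair? : ∀ {n} (a b p q : Fin n) → Dec (SamePair a b p q)
samePair? a b p q = (p ≟ᶠ a ×-dec q ≟ᶠ b) ⊎-dec (p ≟ᶠ b ×-dec q ≟ᶠ a)

SamePair-swap : ∀ {n} {a b p q : Fin n} → SamePair a b p q → SamePair a b q p
SamePair-swap (inj₁ (p≡a , q≡b)) = inj₂ (q≡b , p≡a)
SamePair-swap (inj₂ (p≡b , q≡a)) = inj₁ (q≡a , p≡b)

SamePair-flip : ∀ {n} {a b p q : Fin n} → SamePair a b p q → SamePair b a p q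
SamePair-flip (inj₁ same) = inj₂ same
SamePair-flip (inj₂ same) = inj₁ same

upper : ∀ {n} → EdgeSet n → EdgeSet n
upper M u v = M u v ∧ (toℕ u <ᵇ toℕ v)

-- `size` sums the rows `count (upper M u)` with a function local to its definition;
-- that function is named here by unification against an instance of `size`.
mutual
  sizeSum : ∀ {m} → (Fin m → ℕ) → ℕ
  sizeSum = _

  private
    sizeSum-is-local : ∀ n → size {n} (λ _ _ → false)
                           ≡ sizeSum (λ u → count (upper {n} (λ _ _ → false) u))
    sizeSum-is-local n with (λ (u : Fin n) → count (upper {n} (λ _ _ → false) u))
    ... | rows = refl

size≡sum : ∀ {n} (M : EdgeSet n) → size M ≡ sum (λ u → count (upper M u))
size≡sum M = sizeSum≡sum (λ u → count (upper M u))
  where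
  sizeSum≡sum : ∀ {m} (f : Fin m → ℕ) → sizeSum f ≡ sum f
  sizeSum≡sum {zero}  f = refl
  sizeSum≡sum {suc m} f = cong (f zero +_) (sizeSum≡sum (f ∘ suc))

size-cong : ∀ {n} {M N : EdgeSet n} → (∀ p q → M p q ≡ N p q) → size M ≡ size N
size-cong {M = M} {N} M≗N = begin
  size M                         ≡⟨ size≡sum M ⟩
  sum (λ u → count (upper M u))  ≡⟨ sum-cong-≗ (λ u → count-cong (λ v → cong (_∧ _) (M≗N u v))) ⟩
  sum (λ u → count (upper N u))  ≡⟨ size≡sum N ⟨
  size N                         ∎
  where open ≡-Reasoning

∑count-suc-at : ∀ {n} {F G : Fin n → Fin n → Bool} (a b : Fin n) → F a b ≡ false → G a b ≡ true
              → (∀ p q → ¬ (p ≡ a × q ≡ b) → F p q ≡ G p q)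
              → sum (λ p → count (G p)) ≡ suc (sum (λ p → count (F p)))
∑count-suc-at a b Fab Gab elsewhere =
  sum-suc-at a (count-suc-at b Fab Gab (λ q q≢b → elsewhere a q λ (_ , q≡b) → q≢b q≡b))
               (λ p p≢a → count-cong (λ q → elsewhere p q λ (p≡a , _) → p≢a p≡a))

size-suc-ordered : ∀ {n} {A B : EdgeSet n} (a b : Fin n) → toℕ a < toℕ b → A a b ≡ false → B a b ≡ true
                 → (∀ p q → ¬ SamePair a b p q → A p q ≡ B p q) → size B ≡ suc (size A)
size-suc-ordered {A = A} {B} a b a<b Aab Bab elsewhere = begin
  size B                               ≡⟨ size≡sum B ⟩
  sum (λ p → count (upper B p))        ≡⟨ ∑count-suc-at a b (cong (_∧ _) Aab) (cong₂ _∧_ Bab a<ᵇb)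
                                                            upper-elsewhere ⟩
  suc (sum (λ p → count (upper A p)))  ≡⟨ cong suc (size≡sum A) ⟨
  suc (size A)                         ∎
  where
  open ≡-Reasoning
  a<ᵇb : (toℕ a <ᵇ toℕ b) ≡ true
  a<ᵇb = Equivalence.to T-≡ (<⇒<ᵇ a<b)
  upper-elsewhere : ∀ p q → ¬ (p ≡ a × q ≡ b) → upper A p q ≡ upper B p q
  upper-elsewhere p q ¬ab with samePair? a b p q
  ... | no ¬same      = cong (_∧ _) (elsewhere p q ¬same)
  ... | yes (inj₁ ab) = contradiction ab ¬ab
  ... | yes (inj₂ (refl , refl)) with toℕ b <ᵇ toℕ a in b<ᵇa
  ...   | true  = contradiction (<ᵇ⇒< (toℕ b) (toℕ a) (Equivalence.from T-≡ b<ᵇa)) (<-asym a<b)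
  ...   | false = trans (∧-zeroʳ (A b a)) (sym (∧-zeroʳ (B b a)))

size-suc : ∀ {n} {A B : EdgeSet n} (a b : Fin n) → a ≢ b
         → A a b ≡ false → A b a ≡ false → B a b ≡ true → B b a ≡ true
         → (∀ p q → ¬ SamePair a b p q → A p q ≡ B p q) → size B ≡ suc (size A)
size-suc a b a≢b Aab Aba Bab Bba elsewhere with <-cmp (toℕ a) (toℕ b)
... | tri< a<b _ _ = size-suc-ordered a b a<b Aab Bab elsewhere
... | tri≈ _ a≡b _ = contradiction (toℕ-injective a≡b) a≢b
... | tri> _ _ b<a = size-suc-ordered b a b<a Aba Bba (λ p q ¬same → elsewhere p q (¬same ∘ SamePair-flip))

-- Opaque, so that case splits on `_≟_` in later proofs cannot rewrite inside an update.
opaque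
  _[_─_]≔_ : ∀ {n} → EdgeSet n → Fin n → Fin n → Bool → EdgeSet n
  (M [ a ─ b ]≔ β) p q with samePair? a b p q
  ... | yes _ = β
  ... | no _  = M p q

  ≔-here : ∀ {n} (M : EdgeSet n) {a b β p q} → SamePair a b p q → (M [ a ─ b ]≔ β) p q ≡ β
  ≔-here M {a} {b} {p = p} {q} same with samePair? a b p q
  ... | yes _     = refl
  ... | no ¬same  = contradiction same ¬same

  ≔-elsewhere : ∀ {n} (M : EdgeSet n) {a b β p q} → ¬ SamePair a b p q → (M [ a ─ b ]≔ β) p q ≡ M p q
  ≔-elsewhere M {a} {b} {p = p} {q} ¬same with samePair? a b p q
  ... | yes same = contradiction same ¬same
  ... | no _     = refl

  ≔true-cases : ∀ {n} {M : EdgeSet n} {a b p q} → (M [ a ─ b ]≔ true) p q ≡ true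
              → M p q ≡ true ⊎ SamePair a b p q
  ≔true-cases {M = M} {a} {b} {p} {q} edge with samePair? a b p q
  ... | yes same = inj₂ same
  ... | no _     = inj₁ edge

  ≔false-⊆ : ∀ {n} {M : EdgeSet n} {a b p q} → (M [ a ─ b ]≔ false) p q ≡ true → M p q ≡ true
  ≔false-⊆ {M = M} {a} {b} {p} {q} edge with samePair? a b p q
  ... | no _ = edge

≔-flip : ∀ {n} (M : EdgeSet n) {a b β} p q → (M [ a ─ b ]≔ β) p q ≡ (M [ b ─ a ]≔ β) p q
≔-flip M {a} {b} p q with samePair? a b p q
... | yes same = trans (≔-here M same) (sym (≔-here M (SamePair-flip same)))
... | no ¬same = trans (≔-elsewhere M ¬same) (sym (≔-elsewhere M (¬same ∘ SamePair-flip)))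

≔-sym : ∀ {n} {M : EdgeSet n} {a b β} → (∀ p q → M p q ≡ M q p)
      → ∀ p q → (M [ a ─ b ]≔ β) p q ≡ (M [ a ─ b ]≔ β) q p
≔-sym {M = M} {a} {b} M-sym p q with samePair? a b p q
... | yes same = trans (≔-here M same) (sym (≔-here M (SamePair-swap same)))
... | no ¬same = trans (≔-elsewhere M ¬same) (trans (M-sym p q) (sym (≔-elsewhere M (¬same ∘ SamePair-swap))))

degree-≔-elsewhere : ∀ {n} (M : EdgeSet n) {a b β p} → p ≢ a → p ≢ b
                   → nbrCount (M [ a ─ b ]≔ β) p ≡ nbrCount M p
degree-≔-elsewhere M {a} {b} {β} {p} p≢a p≢b = count-cong {p = (M [ a ─ b ]≔ β) p} λ q → ≔-elsewhere M λ
  { (inj₁ (p≡a , _)) → p≢a p≡a ; (inj₂ (p≡b , _)) → p≢b p≡b }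

row-≔-elsewhere : ∀ {n} (M : EdgeSet n) {a b β} → a ≢ b → ∀ q → q ≢ b → M a q ≡ (M [ a ─ b ]≔ β) a q
row-≔-elsewhere M a≢b q q≢b = sym (≔-elsewhere M λ
  { (inj₁ (_ , q≡b)) → q≢b q≡b ; (inj₂ (a≡b , _)) → a≢b a≡b })

degree-insert : ∀ {n} (M : EdgeSet n) {a b} → a ≢ b → M a b ≡ false
              → nbrCount (M [ a ─ b ]≔ true) a ≡ suc (nbrCount M a)
degree-insert M {a} {b} a≢b Mab =
  count-suc-at {p = M a} b Mab (≔-here M {a} {b} (inj₁ (refl , refl))) (row-≔-elsewhere M a≢b)

degree-delete : ∀ {n} (M : EdgeSet n) {a b} → a ≢ b → M a b ≡ true
              → nbrCount M a ≡ suc (nbrCount (M [ a ─ b ]≔ false) a)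
degree-delete M {a} {b} a≢b Mab =
  count-suc-at {p = (M [ a ─ b ]≔ false) a} b (≔-here M {a} {b} (inj₁ (refl , refl))) Mab
               (λ q q≢b → sym (row-≔-elsewhere M a≢b q q≢b))

module EdgeSubset {n} (G : Graph n) (M : EdgeSet n) (M⊆G : IsEdgeSubset G M) where

  loop-free : ∀ p → M p p ≢ true
  loop-free p Mpp = not-¬ (irrefl G p) (proj₂ M⊆G p p Mpp)

  endpoints-distinct : ∀ {p q} → M p q ≡ true → p ≢ q
  endpoints-distinct {p} Mpq refl = loop-free p Mpq

  insert-edgeSubset : ∀ {a b} → adj G a b ≡ true → IsEdgeSubset G (M [ a ─ b ]≔ true)
  insert-edgeSubset {a} {b} Gab = ≔-sym (proj₁ M⊆G) , in-G
    where
    in-G : ∀ p q → (M [ a ─ b ]≔ true) p q ≡ true → adj G p q ≡ true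
    in-G p q edge with ≔true-cases {M = M} edge
    ... | inj₁ Mpq                  = proj₂ M⊆G p q Mpq
    ... | inj₂ (inj₁ (refl , refl)) = Gab
    ... | inj₂ (inj₂ (refl , refl)) = trans (Graph.sym G b a) Gab

  delete-edgeSubset : ∀ {a b} → IsEdgeSubset G (M [ a ─ b ]≔ false)
  delete-edgeSubset = ≔-sym (proj₁ M⊆G) , λ p q → proj₂ M⊆G p q ∘ ≔false-⊆ {M = M}

  module _ {O : EdgeSet n} {a b} (O-tf : TriangleFree O)
           (M⊆O+ab : ∀ p q → M p q ≡ true → (O [ a ─ b ]≔ true) p q ≡ true)
           (common-dropped : ∀ w → O a w ≡ true → O b w ≡ true → M b w ≡ false) where

    private
      no-common-neighbour : ∀ {w} → M a w ≡ true → M b w ≡ true → ⊥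
      no-common-neighbour {w} Maw Mbw = not-¬ (common-dropped w (in-O Maw) (in-O Mbw)) Mbw
        where
        in-O : ∀ {c} → M c w ≡ true → O c w ≡ true
        in-O {c} Mcw with ≔true-cases {M = O} (M⊆O+ab c w Mcw)
        ... | inj₁ Ocw               = Ocw
        ... | inj₂ (inj₁ (_ , refl)) = ⊥-elim (loop-free b Mbw)
        ... | inj₂ (inj₂ (_ , refl)) = ⊥-elim (loop-free a Maw)

      through-ab : ∀ {p q r} → SamePair a b p q → M q r ≡ true → M r p ≡ true → ⊥
      through-ab (inj₁ (refl , refl)) Mbr Mra = no-common-neighbour (trans (proj₁ M⊆G _ _) Mra) Mbr
      through-ab (inj₂ (refl , refl)) Mar Mrb = no-common-neighbour Mar (trans (proj₁ M⊆G _ _) Mrb)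

    triangleFree-⊆-insert : TriangleFree M
    triangleFree-⊆-insert x y z Mxy Myz Mzx
      with ≔true-cases {M = O} (M⊆O+ab x y Mxy)
         | ≔true-cases {M = O} (M⊆O+ab y z Myz)
         | ≔true-cases {M = O} (M⊆O+ab z x Mzx)
    ... | inj₁ Oxy | inj₁ Oyz | inj₁ Ozx = O-tf x y z Oxy Oyz Ozx
    ... | inj₂ xy  | _        | _        = through-ab xy Myz Mzx
    ... | inj₁ _   | inj₂ yz  | _        = through-ab yz Mzx Mxy
    ... | inj₁ _   | inj₁ _   | inj₂ zx  = through-ab zx Mxy Myz

≢-by-value : ∀ {n} (M : EdgeSet n) {p q r} → M p q ≡ true → M p r ≡ false → q ≢ r
≢-by-value M Mpq Mpr refl = not-¬ Mpr Mpq

module Exchange {n} {G : Graph n} {A O : EdgeSet n}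
  (A-tf2 : IsTF2Matching G A) (O-max : IsMaxTF2Matching G O)
  (O-closest : ∀ M → IsMaxTF2Matching G M → size (A ∩ M) ≤ size (A ∩ O)) where

  private
    A⊆G : IsEdgeSubset G A
    A⊆G = proj₁ (proj₁ A-tf2)
    A-degree : ∀ p → nbrCount A p ≤ 2
    A-degree = proj₂ (proj₁ A-tf2)
    A-tf : TriangleFree A
    A-tf = proj₂ A-tf2
    O⊆G : IsEdgeSubset G O
    O⊆G = proj₁ (proj₁ (proj₁ O-max))
    O-degree : ∀ p → nbrCount O p ≤ 2
    O-degree = proj₂ (proj₁ (proj₁ O-max))
    O-tf : TriangleFree O
    O-tf = proj₂ (proj₁ O-max)
    O-largest : ∀ M → IsTF2Matching G M → size M ≤ size O
    O-largest = proj₂ O-max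

  open EdgeSubset G

  module Insertion {u v} (Auv : A u v ≡ true) (Ouv : O u v ≡ false) (O-degree-u : nbrCount O u ≤ 1) where

    private
      u≢v : u ≢ v
      u≢v = endpoints-distinct A A⊆G Auv
      Ovu : O v u ≡ false
      Ovu = trans (proj₁ O⊆G v u) Ouv
      Avu : A v u ≡ true
      Avu = trans (proj₁ A⊆G v u) Auv

    O+uv : EdgeSet n
    O+uv = O [ u ─ v ]≔ true

    O+uv⊆G : IsEdgeSubset G O+uv
    O+uv⊆G = insert-edgeSubset O O⊆G (proj₂ A⊆G u v Auv)

    O+uv-degree-u : nbrCount O+uv u ≤ 2
    O+uv-degree-u = ≤-trans (≤-reflexive (degree-insert O u≢v Ouv)) (s≤s O-degree-u)

    O+uv-degree-v : nbrCount O+uv v ≡ suc (nbrCount O v)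
    O+uv-degree-v = trans (count-cong {p = O+uv v} (≔-flip O v)) (degree-insert O (u≢v ∘ sym) Ovu)

    O+uv-degree-≢v : ∀ p → p ≢ v → nbrCount O+uv p ≤ 2
    O+uv-degree-≢v p p≢v with p ≟ᶠ u
    ... | yes p≡u = subst (λ p → nbrCount O+uv p ≤ 2) (sym p≡u) O+uv-degree-u
    ... | no  p≢u = ≤-trans (≤-reflexive (degree-≔-elsewhere O p≢u p≢v)) (O-degree p)

    size-O+uv : size O+uv ≡ suc (size O)
    size-O+uv = size-suc u v u≢v Ouv Ovu (≔-here O (inj₁ (refl , refl))) (≔-here O (inj₂ (refl , refl)))
                         (λ p q ¬uv → sym (≔-elsewhere O ¬uv))

    size-A∩O+uv : size (A ∩ O+uv) ≡ suc (size (A ∩ O))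
    size-A∩O+uv =
      size-suc u v u≢v (trans (cong (A u v ∧_) Ouv) (∧-zeroʳ _)) (trans (cong (A v u ∧_) Ovu) (∧-zeroʳ _))
               (cong₂ _∧_ Auv (≔-here O (inj₁ (refl , refl)))) (cong₂ _∧_ Avu (≔-here O (inj₂ (refl , refl))))
               (λ p q ¬uv → cong (A p q ∧_) (sym (≔-elsewhere O ¬uv)))

    augmentation-impossible : nbrCount O v ≤ 1 → (∀ w → O u w ≡ true → O v w ≡ true → ⊥) → ⊥
    augmentation-impossible O-degree-v disjoint = ≤⇒≯ (O-largest O+uv O+uv-tf2) (≤-reflexive (sym size-O+uv))
      where
      O+uv-degree : ∀ p → nbrCount O+uv p ≤ 2
      O+uv-degree p with p ≟ᶠ v
      ... | yes p≡v = subst (λ p → nbrCount O+uv p ≤ 2) (sym p≡v)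
                            (≤-trans (≤-reflexive O+uv-degree-v) (s≤s O-degree-v))
      ... | no  p≢v = O+uv-degree-≢v p p≢v
      O+uv-tf2 : IsTF2Matching G O+uv
      O+uv-tf2 = (O+uv⊆G , O+uv-degree)
               , triangleFree-⊆-insert O+uv O+uv⊆G O-tf (λ _ _ → id)
                                       (λ w Ouw Ovw → ⊥-elim (disjoint w Ouw Ovw))

    module Swap {y} (Ovy : O v y ≡ true) (Avy : A v y ≡ false)
                (only-y : ∀ w → O u w ≡ true → O v w ≡ true → w ≡ y) where

      private
        v≢y : v ≢ y
        v≢y = endpoints-distinct O O⊆G Ovy
        vy∈O+uv : O+uv v y ≡ true
        vy∈O+uv = trans (≔-elsewhere O vy≠uv) Ovy
          where
          vy≠uv : ¬ SamePair u v v y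
          vy≠uv (inj₁ (v≡u , _)) = u≢v (sym v≡u)
          vy≠uv (inj₂ (_ , y≡u)) = ≢-by-value O Ovy Ovu y≡u

      O+uv-vy : EdgeSet n
      O+uv-vy = O+uv [ v ─ y ]≔ false

      O+uv-vy⊆G : IsEdgeSubset G O+uv-vy
      O+uv-vy⊆G = delete-edgeSubset O+uv O+uv⊆G

      O+uv-vy⊆O+uv : ∀ p q → O+uv-vy p q ≡ true → O+uv p q ≡ true
      O+uv-vy⊆O+uv p q = ≔false-⊆ {M = O+uv}

      size-O+uv-vy : size O+uv ≡ suc (size O+uv-vy)
      size-O+uv-vy = size-suc v y v≢y (≔-here O+uv (inj₁ (refl , refl))) (≔-here O+uv (inj₂ (refl , refl)))
                              vy∈O+uv (trans (proj₁ O+uv⊆G y v) vy∈O+uv) (λ p q ¬vy → ≔-elsewhere O+uv ¬vy)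

      A∩O+uv-vy≗A∩O+uv : ∀ p q → (A ∩ O+uv-vy) p q ≡ (A ∩ O+uv) p q
      A∩O+uv-vy≗A∩O+uv p q with samePair? v y p q
      ... | no ¬vy = cong (A p q ∧_) (≔-elsewhere O+uv ¬vy)
      ... | yes (inj₁ (refl , refl)) = trans (cong (_∧ O+uv-vy v y) Avy) (cong (_∧ O+uv v y) (sym Avy))
      ... | yes (inj₂ (refl , refl)) = trans (cong (_∧ O+uv-vy y v) Ayv) (cong (_∧ O+uv y v) (sym Ayv))
        where
        Ayv : A y v ≡ false
        Ayv = trans (proj₁ A⊆G y v) Avy

      size-A∩O+uv-vy : size (A ∩ O+uv-vy) ≡ suc (size (A ∩ O))
      size-A∩O+uv-vy = trans (size-cong A∩O+uv-vy≗A∩O+uv) size-A∩O+uv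

      O+uv-vy-degree-v : nbrCount O+uv-vy v ≡ nbrCount O v
      O+uv-vy-degree-v = suc-injective (trans (sym (degree-delete O+uv v≢y vy∈O+uv)) O+uv-degree-v)

      O+uv-vy-degree : ∀ p → nbrCount O+uv-vy p ≤ 2
      O+uv-vy-degree p with p ≟ᶠ v
      ... | yes p≡v = subst (λ p → nbrCount O+uv-vy p ≤ 2) (sym p≡v)
                            (≤-trans (≤-reflexive O+uv-vy-degree-v) (O-degree v))
      ... | no  p≢v = ≤-trans (count-mono {p = O+uv-vy p} {q = O+uv p} (O+uv-vy⊆O+uv p)) (O+uv-degree-≢v p p≢v)

      O+uv-vy-tf : TriangleFree O+uv-vy
      O+uv-vy-tf = triangleFree-⊆-insert O+uv-vy O+uv-vy⊆G O-tf O+uv-vy⊆O+uv vy-dropped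
        where
        vy-dropped : ∀ w → O u w ≡ true → O v w ≡ true → O+uv-vy v w ≡ false
        vy-dropped w Ouw Ovw rewrite only-y w Ouw Ovw = ≔-here O+uv (inj₁ (refl , refl))

      O+uv-vy-max : IsMaxTF2Matching G O+uv-vy
      O+uv-vy-max = ((O+uv-vy⊆G , O+uv-vy-degree) , O+uv-vy-tf)
                  , λ N N-tf2 → ≤-trans (O-largest N N-tf2) (≤-reflexive same-size)
        where
        same-size : size O ≡ size O+uv-vy
        same-size = suc-injective (trans (sym size-O+uv) size-O+uv-vy)

    swap-impossible : ∀ {y} → O v y ≡ true → A v y ≡ false → (∀ w → O u w ≡ true → O v w ≡ true → w ≡ y) → ⊥
    swap-impossible Ovy Avy only-y = ≤⇒≯ (O-closest O+uv-vy O+uv-vy-max) (≤-reflexive (sym size-A∩O+uv-vy))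
      where open Swap Ovy Avy only-y

    O-neighbour-outside-A : 1 < nbrCount O v → ∃ λ w → O v w ≡ true × A v w ≡ false
    O-neighbour-outside-A >1 with ∃-of-count< (O v) (A v ─ u) Av-u<Ov
      where
      Av-u<Ov : count (A v ─ u) < count (O v)
      Av-u<Ov = ≤-trans (≤-reflexive (sym (count-─ (A v) Avu))) (≤-trans (A-degree v) >1)
    ... | w , Ovw , w∉Av-u = w , Ovw , trans (sym (─-elsewhere (A v) (≢-by-value O Ovw Ovu))) w∉Av-u

    no-exchangeable-edge : (∀ x → O u x ≡ true → O v x ≡ true → A v x ≡ false) → ⊥
    no-exchangeable-edge A-avoids with any? (λ y → (O u y ≟ᵇ true) ×-dec (O v y ≟ᵇ true))
    ... | yes (y , Ouy , Ovy) =
      swap-impossible Ovy (A-avoids y Ouy Ovy) (λ w Ouw _ → count≤1⇒unique (O u) O-degree-u Ouy Ouw)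
    ... | no disjoint with nbrCount O v ≤? 1
    ...   | yes O-degree-v = augmentation-impossible O-degree-v (λ w Ouw Ovw → disjoint (w , Ouw , Ovw))
    ...   | no  O-degree-v with O-neighbour-outside-A (≰⇒> O-degree-v)
    ...     | w , Ovw , Avw = swap-impossible Ovw Avw (λ w′ Ouw′ Ovw′ → ⊥-elim (disjoint (w′ , Ouw′ , Ovw′)))

  exchangeable-edge : ∀ {u} → nbrCount O u < nbrCount A u
    → ∃ λ v → A u v ≡ true × O u v ≡ false × (∀ x → O u x ≡ true → O v x ≡ true → A v x ≡ false)
  exchangeable-edge {u} deficient with ∃-of-count< (A u) (O u) deficient
  ... | v , Auv , Ouv with any? (λ x → (O u x ≟ᵇ true) ×-dec ((O v x ≟ᵇ true) ×-dec (A v x ≟ᵇ true)))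
  ...   | no none = v , Auv , Ouv , λ x Oux Ovx → ¬-not λ Avx → none (x , Oux , Ovx , Avx)
  -- x is the only O-neighbour of u and ux ∉ A (else uvx is an A-triangle), so u has another
  -- A-neighbour v′ with uv′ ∉ O; a common O-neighbour of u and v′ would be x, adjacent to u, v, v′.
  ...   | yes (x , Oux , Ovx , Avx) with ∃-other (A u) (≤-trans (s≤s (0<count (O u) Oux)) deficient) Auv
  ...     | v′ , Auv′ , v′≢v = v′ , Auv′ , Ouv′ , λ x′ Oux′ Ov′x′ → x-saturated (x-only Oux′) Ov′x′
    where
    Aux : A u x ≡ false
    Aux = ¬-not λ Aux → A-tf u v x Auv Avx (trans (proj₁ A⊆G x u) Aux)
    x-only : ∀ {y} → O u y ≡ true → y ≡ x
    x-only = count≤1⇒unique (O u) (≤-pred (≤-trans deficient (A-degree u))) Oux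
    Ouv′ : O u v′ ≡ false
    Ouv′ = ¬-not λ Ouv′ → ≢-by-value A Auv′ Aux (x-only Ouv′)
    x-saturated : ∀ {x′} → x′ ≡ x → O v′ x′ ≡ true → A v′ x′ ≡ false
    x-saturated refl Ov′x = contradiction
      (2<count (O x) (endpoints-distinct A A⊆G Auv ∘ sym) (endpoints-distinct A A⊆G Auv′ ∘ sym) v′≢v
               (trans (proj₁ O⊆G x u) Oux) (trans (proj₁ O⊆G x v) Ovx) (trans (proj₁ O⊆G x v′) Ov′x))
      (≤⇒≯ (O-degree x))

  no-deficient-vertex : ∀ u → ¬ nbrCount O u < nbrCount A u
  no-deficient-vertex u deficient with exchangeable-edge deficient
  ... | v , Auv , Ouv , A-avoids =
    Insertion.no-exchangeable-edge Auv Ouv (≤-pred (≤-trans deficient (A-degree u))) A-avoids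

lemma5 : ∀ (n : ℕ) (G : Graph n) (APX OPT : EdgeSet n)
         → IsTF2Matching G APX
         → IsMaxTF2Matching G OPT
         → (∀ M → IsMaxTF2Matching G M → size (APX ∩ M) ≤ size (APX ∩ OPT))
         → ∀ (u : Fin n) → nbrCount APX u ≤ nbrCount OPT u
lemma5 n G APX OPT APX-tf2 OPT-max OPT-closest u =
  ≮⇒≥ (Exchange.no-deficient-vertex {G = G} {APX} {OPT} APX-tf2 OPT-max OPT-closest u)
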